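{- If $o$ is a $\lambda\mu$-object and $o\to_{\lambda\mu}o'$, then $o\to^{+}_{\lambda\mu\mathtt{s}}o'$ (one or more $\lambda\mu\mathtt{s}$-steps, objects being identified up to renaming of bound variables and names).
   Context: $\lambda\mu$: terms $t,u::=x\mid\lambda x.t\mid t\,u\mid\mu\alpha.c$, commands $c::=[\alpha]t$, objects $o::=t\mid c$; $\lambda x$ binds $x$, $\mu\alpha$ binds $\alpha$; $\mathrm{fn}([\alpha]t)=\mathrm{fn}(t)\cup\{\alpha\}$. $o\{x/u\}$ is capture-avoiding substitution; replacement $o\{\alpha/\!\!/u\}$: $x\{\alpha/\!\!/u\}=x$, homomorphic on abstraction, application and $\mu\gamma$, $([\gamma]t)\{\alpha/\!\!/u\}=[\gamma](t\{\alpha/\!\!/u\})$ for $\gamma\neq\alpha$, $([\alpha]t)\{\alpha/\!\!/u\}=[\alpha]((t\{\alpha/\!\!/u\})\,u)$. $\to_{\lambda\mu}$ is the closure under all contexts of $(\lambda x.t)u\to t\{x/u\}$ and $(\mu\alpha.c)u\to\mu\alpha.(c\{\alpha/\!\!/u\})$. $\lambda\mu\mathtt{s}$ extends the syntax with $t[x/u]$ (binds $x$ in $t$) and commands $c\langle\alpha/\!\!/\beta.u\rangle$ (binds $\alpha$ in $c$; $\mathrm{fn}=(\mathrm{fn}(c)\setminus\{\alpha\})\cup\{\beta\}\cup\mathrm{fn}(u)$); $|o|_x$, $|o|_\alpha$ count free occurrences. Contexts: $\mathtt{L}::=\Box\mid\mathtt{L}[x/u]$; $\mathtt{TT}::=\Box\mid\lambda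 x.\mathtt{TT}\mid\mathtt{TT}\,t\mid t\,\mathtt{TT}\mid\mu\alpha.\mathtt{CT}\mid\mathtt{TT}[x/t]\mid t[x/\mathtt{TT}]$, $\mathtt{CT}::=[\alpha]\mathtt{TT}\mid\mathtt{CT}\langle\alpha/\!\!/\beta.u\rangle\mid c\langle\alpha/\!\!/\beta.\mathtt{TT}\rangle$; $\mathtt{TC}::=\lambda x.\mathtt{TC}\mid\mathtt{TC}\,t\mid t\,\mathtt{TC}\mid\mu\alpha.\mathtt{CC}\mid\mathtt{TC}[x/t]\mid t[x/\mathtt{TC}]$, $\mathtt{CC}::=\boxdot\mid[\alpha]\mathtt{TC}\mid\mathtt{CC}\langle\alpha/\!\!/\beta.u\rangle\mid c\langle\alpha/\!\!/\beta.\mathtt{TC}\rangle$. $\to_{\lambda\mu\mathtt{s}}$ is the closure under all contexts of: $\mathtt{L}[\lambda x.t]\,u\to\mathtt{L}[t[x/u]]$; $\mathtt{TT}[x][x/u]\to\mathtt{TT}[u][x/u]$ if $|\mathtt{TT}[x]|_x>1$; $\mathtt{TT}[x][x/u]\to\mathtt{TT}[u]$ if $|\mathtt{TT}[x]|_x=1$; $t[x/u]\to t$ if $x\notin\mathrm{fv}(t)$; $\mathtt{L}[\mu\alpha.c]\,u\to\mathtt{L}[\mu\gamma.c\langle\alpha/\!\!/\gamma.u\rangle]$, $\gamma$ fresh; $\mathtt{CC}[[\alpha]t]\langle\alpha/\!\!/\gamma.u\rangle\to\mathtt{CC}[[\gamma]t\,u]\langle\alpha/\!\!/\gamma.u\rangle$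 if $|\mathtt{CC}[[\alpha]t]|_\alpha>1$; $\mathtt{CC}[[\alpha]t]\langle\alpha/\!\!/\gamma.u\rangle\to\mathtt{CC}[[\gamma]t\,u]$ if $|\mathtt{CC}[[\alpha]t]|_\alpha=1$; $c\langle\alpha/\!\!/\gamma.u\rangle\to c$ if $\alpha\notin\mathrm{fn}(c)$; where $\mathtt{TT}$ does not bind $x$ and $\mathtt{CC}$ does not bind $\alpha,\gamma$. -}

module Defs where

-- Working with de Bruijn indices realises "objects identified up to
-- renaming of bound variables and names" (α-equivalence is syntactic equality).

open import Data.Nat using (ℕ; zero; suc; _+_; _<ᵇ_; _≡ᵇ_; _>_; pred)
open import Data.Bool using (Bool; true; false; if_then_else_)
open import Relation.Binary.PropositionalEquality using (_≡_)
open import Relation.Binary.Construct.Closure.Transitive using (TransClosure)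

shiftIdx : ℕ → ℕ → ℕ
shiftIdx k i = if i <ᵇ k then i else suc i

module LM where

  mutual
    data Tm : Set where
      var : ℕ → Tm
      lam : Tm → Tm           -- λx.t   (binds term var 0)
      app : Tm → Tm → Tm
      mu  : Cmd → Tm          -- μα.c   (binds name 0)

    data Cmd : Set where
      named : ℕ → Tm → Cmd

  mutual
    tsh : ℕ → Tm → Tm
    tsh k (var i)   = var (shiftIdx k i)
    tsh k (lam t)   = lam (tsh (suc k) t)
    tsh k (app t u) = app (tsh k t) (tsh k u)
    tsh k (mu c)    = mu (tshC k c)

    tshC : ℕ → Cmd → Cmd
    tshC k (named a t) = named a (tsh k t)

  mutual
    nsh : ℕ → Tm → Tm
    nsh k (var i)   = var i
    nsh k (lam t)   = lam (nsh k t)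
    nsh k (app t u) = app (nsh k t) (nsh k u)
    nsh k (mu c)    = mu (nshC (suc k) c)

    nshC : ℕ → Cmd → Cmd
    nshC k (named a t) = named (shiftIdx k a) (nsh k t)

  -- capture-avoiding substitution: subst k u t replaces var k by u
  -- (u given at the current depth) and lowers the variables above k.
  mutual
    subst : ℕ → Tm → Tm → Tm
    subst k u (var j)   = if j ≡ᵇ k then u else (if j <ᵇ k then var j else var (pred j))
    subst k u (lam t)   = lam (subst (suc k) (tsh 0 u) t)
    subst k u (app t s) = app (subst k u t) (subst k u s)
    subst k u (mu c)    = mu (substC k (nsh 0 u) c)

    substC : ℕ → Tm → Cmd → Cmd
    substC k u (named a t) = named a (subst k u t)

  -- replacement o{α //u}: repl a u o, u given at the current depth
  mutual
    repl : ℕ → Tm → Tm → Tm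
    repl a u (var x)   = var x
    repl a u (lam t)   = lam (repl a (tsh 0 u) t)
    repl a u (app t s) = app (repl a u t) (repl a u s)
    repl a u (mu c)    = mu (replC (suc a) (nsh 0 u) c)

    replC : ℕ → Tm → Cmd → Cmd
    replC a u (named b t) =
      if b ≡ᵇ a then named b (app (repl a u t) u) else named b (repl a u t)

  mutual
    data _⟶_ : Tm → Tm → Set where
      β    : ∀ {t u} → app (lam t) u ⟶ subst 0 u t
      μ    : ∀ {c u} → app (mu c) u ⟶ mu (replC 0 (nsh 0 u) c)
      lamᶜ : ∀ {t t'} → t ⟶ t' → lam t ⟶ lam t'
      appˡ : ∀ {t t' u} → t ⟶ t' → app t u ⟶ app t' u
      appʳ : ∀ {t u u'} → u ⟶ u' → app t u ⟶ app t u'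
      muᶜ  : ∀ {c c'} → c ⟶C c' → mu c ⟶ mu c'

    data _⟶C_ : Cmd → Cmd → Set where
      namedᶜ : ∀ {a t t'} → t ⟶ t' → named a t ⟶C named a t'

module LMS where

  mutual
    data Tm : Set where
      var  : ℕ → Tm
      lam  : Tm → Tm
      app  : Tm → Tm → Tm
      mu   : Cmd → Tm
      esub : Tm → Tm → Tm          -- esub t u = t[x/u], binds term var 0 in t

    data Cmd : Set where
      named : ℕ → Tm → Cmd
      rsub  : Cmd → ℕ → Tm → Cmd   -- rsub c β u = c⟨α//β.u⟩, binds name 0 (α) in c;
                                   -- β and u live in the outer scope

  mutual
    tsh : ℕ → Tm → Tm
    tsh k (var i)    = var (shiftIdx k i)
    tsh k (lam t)    = lam (tsh (suc k) t)
    tsh k (app t u)  = app (tsh k t) (tsh k u)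
    tsh k (mu c)     = mu (tshC k c)
    tsh k (esub t u) = esub (tsh (suc k) t) (tsh k u)

    tshC : ℕ → Cmd → Cmd
    tshC k (named a t)  = named a (tsh k t)
    tshC k (rsub c b u) = rsub (tshC k c) b (tsh k u)

  mutual
    nsh : ℕ → Tm → Tm
    nsh k (var i)    = var i
    nsh k (lam t)    = lam (nsh k t)
    nsh k (app t u)  = app (nsh k t) (nsh k u)
    nsh k (mu c)     = mu (nshC (suc k) c)
    nsh k (esub t u) = esub (nsh k t) (nsh k u)

    nshC : ℕ → Cmd → Cmd
    nshC k (named a t)  = named (shiftIdx k a) (nsh k t)
    nshC k (rsub c b u) = rsub (nshC (suc k) c) (shiftIdx k b) (nsh k u)

  tshN : ℕ → Tm → Tm
  tshN zero    u = u
  tshN (suc n) u = tsh 0 (tshN n u)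

  ind : Bool → ℕ
  ind true  = 1
  ind false = 0

  mutual
    cntT : ℕ → Tm → ℕ
    cntT i (var j)    = ind (i ≡ᵇ j)
    cntT i (lam t)    = cntT (suc i) t
    cntT i (app t u)  = cntT i t + cntT i u
    cntT i (mu c)     = cntTC i c
    cntT i (esub t u) = cntT (suc i) t + cntT i u

    cntTC : ℕ → Cmd → ℕ
    cntTC i (named a t)  = cntT i t
    cntTC i (rsub c b u) = cntTC i c + cntT i u

  mutual
    cntN : ℕ → Tm → ℕ
    cntN a (var j)    = 0
    cntN a (lam t)    = cntN a t
    cntN a (app t u)  = cntN a t + cntN a u
    cntN a (mu c)     = cntNC (suc a) c
    cntN a (esub t u) = cntN a t + cntN a u

    cntNC : ℕ → Cmd → ℕ
    cntNC a (named b t)  = ind (a ≡ᵇ b) + cntN a t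
    cntNC a (rsub c b u) = cntNC (suc a) c + ind (a ≡ᵇ b) + cntN a u

  data LCtx : Set where
    □    : LCtx
    _[/_] : LCtx → Tm → LCtx

  plugL : LCtx → Tm → Tm
  plugL □ t         = t
  plugL (L [/ u ]) t = esub (plugL L t) u

  depth : LCtx → ℕ
  depth □          = 0
  depth (L [/ u ]) = suc (depth L)

  -- TT[x] ↦ TT[u] with TT not binding x:
  -- RepT i u t t' : t = TT[x], t' = TT[u], where at the current depth x has
  -- index i and u is already shifted to the current depth.
  mutual
    data RepT : ℕ → Tm → Tm → Tm → Set where
      here  : ∀ {i u} → RepT i u (var i) u
      lamᶜ  : ∀ {i u t t'} → RepT (suc i) (tsh 0 u) t t' → RepT i u (lam t) (lam t')
      appˡ  : ∀ {i u t t' s} → RepT i u t t' → RepT i u (app t s) (app t' s)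
      appʳ  : ∀ {i u t s s'} → RepT i u s s' → RepT i u (app t s) (app t s')
      muᶜ   : ∀ {i u c c'} → RepTC i (nsh 0 u) c c' → RepT i u (mu c) (mu c')
      esubˡ : ∀ {i u t t' s} → RepT (suc i) (tsh 0 u) t t' → RepT i u (esub t s) (esub t' s)
      esubʳ : ∀ {i u t s s'} → RepT i u s s' → RepT i u (esub t s) (esub t s')

    data RepTC : ℕ → Tm → Cmd → Cmd → Set where
      namedᶜ : ∀ {i u a t t'} → RepT i u t t' → RepTC i u (named a t) (named a t')
      rsubˡ  : ∀ {i u c c' b s} → RepTC i (nsh 0 u) c c' → RepTC i u (rsub c b s) (rsub c' b s)
      rsubʳ  : ∀ {i u c b s s'} → RepT i u s s' → RepTC i u (rsub c b s) (rsub c b s')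

  -- CC[[α]t] ↦ CC[[γ] t u] with CC not binding α, γ:
  -- RepN a g u c c' : at current depth α has index a, γ has index g,
  -- u already shifted to the current depth.
  mutual
    data RepN : ℕ → ℕ → Tm → Cmd → Cmd → Set where
      here   : ∀ {a g u t} → RepN a g u (named a t) (named g (app t u))
      namedᶜ : ∀ {a g u b t t'} → RepNT a g u t t' → RepN a g u (named b t) (named b t')
      rsubˡ  : ∀ {a g u c c' b s} → RepN (suc a) (suc g) (nsh 0 u) c c'
             → RepN a g u (rsub c b s) (rsub c' b s)
      rsubʳ  : ∀ {a g u c b s s'} → RepNT a g u s s' → RepN a g u (rsub c b s) (rsub c b s')

    data RepNT : ℕ → ℕ → Tm → Tm → Tm → Set where
      lamᶜ  : ∀ {a g u t t'} → RepNT a g (tsh 0 u) t t' → RepNT a g u (lam t) (lam t')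
      appˡ  : ∀ {a g u t t' s} → RepNT a g u t t' → RepNT a g u (app t s) (app t' s)
      appʳ  : ∀ {a g u t s s'} → RepNT a g u s s' → RepNT a g u (app t s) (app t s')
      muᶜ   : ∀ {a g u c c'} → RepN (suc a) (suc g) (nsh 0 u) c c' → RepNT a g u (mu c) (mu c')
      esubˡ : ∀ {a g u t t' s} → RepNT a g (tsh 0 u) t t' → RepNT a g u (esub t s) (esub t' s)
      esubʳ : ∀ {a g u t s s'} → RepNT a g u s s' → RepNT a g u (esub t s) (esub t s')

  mutual
    data _⟶_ : Tm → Tm → Set where
      -- L[λx.t] u → L[t[x/u]]
      dB   : ∀ {L t u} → app (plugL L (lam t)) u ⟶ plugL L (esub t (tshN (depth L) u))
      -- TT[x][x/u] → TT[u][x/u]   if |TT[x]|_x > 1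
      cᵗ   : ∀ {t t' u} → RepT 0 (tsh 0 u) t t' → cntT 0 t > 1 → esub t u ⟶ esub t' u
      -- TT[x][x/u] → TT[u]        if |TT[x]|_x = 1
      dᵗ   : ∀ {t t' t'' u} → RepT 0 (tsh 0 u) t t' → cntT 0 t ≡ 1
           → tsh 0 t'' ≡ t' → esub t u ⟶ t''
      -- t[x/u] → t                if x ∉ fv(t)
      wᵗ   : ∀ {t u} → esub (tsh 0 t) u ⟶ t
      -- L[μα.c] u → L[μγ.c⟨α//γ.u⟩]
      dM   : ∀ {L c u} → app (plugL L (mu c)) u
                         ⟶ plugL L (mu (rsub (nshC 1 c) 0 (nsh 0 (tshN (depth L) u))))
      lamᶜ  : ∀ {t t'} → t ⟶ t' → lam t ⟶ lam t'
      appˡ  : ∀ {t t' u} → t ⟶ t' → app t u ⟶ app t' u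
      appʳ  : ∀ {t u u'} → u ⟶ u' → app t u ⟶ app t u'
      muᶜ   : ∀ {c c'} → c ⟶C c' → mu c ⟶ mu c'
      esubˡ : ∀ {t t' u} → t ⟶ t' → esub t u ⟶ esub t' u
      esubʳ : ∀ {t u u'} → u ⟶ u' → esub t u ⟶ esub t u'

    data _⟶C_ : Cmd → Cmd → Set where
      -- CC[[α]t]⟨α//γ.u⟩ → CC[[γ]t u]⟨α//γ.u⟩   if |CC[[α]t]|_α > 1
      cⁿ : ∀ {c c' g u} → RepN 0 (suc g) (nsh 0 u) c c' → cntNC 0 c > 1
         → rsub c g u ⟶C rsub c' g u
      -- CC[[α]t]⟨α//γ.u⟩ → CC[[γ]t u]            if |CC[[α]t]|_α = 1
      dⁿ : ∀ {c c' c'' g u} → RepN 0 (suc g) (nsh 0 u) c c' → cntNC 0 c ≡ 1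
         → nshC 0 c'' ≡ c' → rsub c g u ⟶C c''
      -- c⟨α//γ.u⟩ → c                            if α ∉ fn(c)
      wⁿ : ∀ {c g u} → rsub (nshC 0 c) g u ⟶C c
      namedᶜ : ∀ {a t t'} → t ⟶ t' → named a t ⟶C named a t'
      rsubˡ  : ∀ {c c' b u} → c ⟶C c' → rsub c b u ⟶C rsub c' b u
      rsubʳ  : ∀ {c b u u'} → u ⟶ u' → rsub c b u ⟶C rsub c b u'

  _⟶⁺_ : Tm → Tm → Set
  _⟶⁺_ = TransClosure _⟶_

  _⟶C⁺_ : Cmd → Cmd → Set
  _⟶C⁺_ = TransClosure _⟶C_

mutual
  ⌜_⌝ : LM.Tm → LMS.Tm
  ⌜ LM.var x ⌝   = LMS.var x
  ⌜ LM.lam t ⌝   = LMS.lam ⌜ t ⌝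
  ⌜ LM.app t u ⌝ = LMS.app ⌜ t ⌝ ⌜ u ⌝
  ⌜ LM.mu c ⌝    = LMS.mu ⌜ c ⌝C

  ⌜_⌝C : LM.Cmd → LMS.Cmd
  ⌜ LM.named a t ⌝C = LMS.named a ⌜ t ⌝

module Submission where

-- Congruence steps are simulated by lifting through the constructor.  The
-- two root rules are simulated by one λμs-step that creates an explicit
-- operator, followed by the elimination of that operator:
--   (λx.t) u  ⟶dB  t[x/u]         ⟶⁺  t{x/u}
--   (μα.c) u  ⟶dM  μγ.c⟨α//γ.u⟩   ⟶⁺  μγ.(c{α//u} with α renamed γ)
-- Elimination is the generic induction `eliminate` on the number n of free
-- occurrences of the operator's variable: while n > 1 one occurrence is
-- copied (rules cᵗ/cⁿ), the last one is consumed (dᵗ/dⁿ), and with n = 0 the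
-- operator is garbage-collected (wᵗ/wⁿ).  A single copy step is described on
-- λμ-objects by a one-occurrence relation (`FillOne` for a variable,
-- `RedirectOne` for a name) which lowers the count by one, does not change
-- the final result, and translates to the λμs contexts TT resp. CC.

open import Defs
open import Data.Bool using (true; false; if_then_else_; T)
open import Data.Nat using (ℕ; zero; suc; _+_; _<ᵇ_; _≡ᵇ_; _<_; _≤_; pred; s≤s; z≤n; z<s; s<s)
open import Data.Nat.Properties using (≡ᵇ⇒≡; suc-injective; +-suc; +-identityʳ; m+n≡0⇒m≡0; m+n≡0⇒n≡0)
open import Data.Product using (Σ; _×_; _,_)
open import Data.Sum using (_⊎_; inj₁; inj₂)
open import Data.Unit using (tt)
open import Relation.Binary.PropositionalEquality
open import Relation.Binary.Construct.Closure.Transitive using (TransClosure; [_]; _∷_)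

≡ᵇ-refl : ∀ n → (n ≡ᵇ n) ≡ true
≡ᵇ-refl zero    = refl
≡ᵇ-refl (suc n) = ≡ᵇ-refl n

≡ᵇ-sym : ∀ m n → (m ≡ᵇ n) ≡ (n ≡ᵇ m)
≡ᵇ-sym zero    zero    = refl
≡ᵇ-sym zero    (suc n) = refl
≡ᵇ-sym (suc m) zero    = refl
≡ᵇ-sym (suc m) (suc n) = ≡ᵇ-sym m n

≡ᵇ-sound : ∀ m n → (m ≡ᵇ n) ≡ true → m ≡ n
≡ᵇ-sound m n e = ≡ᵇ⇒≡ m n (subst T (sym e) tt)

suc-≢ᵇ : ∀ n → (suc n ≡ᵇ n) ≡ false
suc-≢ᵇ zero    = refl
suc-≢ᵇ (suc n) = suc-≢ᵇ n

ind-zero : ∀ i j → LMS.ind (i ≡ᵇ j) ≡ 0 → (j ≡ᵇ i) ≡ false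
ind-zero i j e with i ≡ᵇ j in eq
... | false = trans (≡ᵇ-sym j i) eq
ind-zero i j () | true

-- `lower k` closes the gap at index k left by a removed binder; it is the
-- index map used by λμ substitution and inverts `shiftIdx k` away from k.
lower : ℕ → ℕ → ℕ
lower k i = if i <ᵇ k then i else pred i

shift-suc : ∀ k i → shiftIdx (suc k) (suc i) ≡ suc (shiftIdx k i)
shift-suc k i with i <ᵇ k
... | true  = refl
... | false = refl

lower-suc : ∀ k i → (i ≡ᵇ k) ≡ false → lower (suc k) (suc i) ≡ suc (lower k i)
lower-suc zero    zero    ()
lower-suc (suc k) zero    _ = refl
lower-suc k       (suc i) _ with suc i <ᵇ k
... | true  = refl
... | false = refl

shift-shift : ∀ {k j} → k ≤ j → ∀ i → shiftIdx k (shiftIdx j i) ≡ shiftIdx (suc j) (shiftIdx k i)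
shift-shift {zero}  {j}     z≤n     i       = sym (shift-suc j i)
shift-shift {suc k} {suc j} (s≤s p) zero    = refl
shift-shift {suc k} {suc j} (s≤s p) (suc i) = begin
  shiftIdx (suc k) (shiftIdx (suc j) (suc i))   ≡⟨ cong (shiftIdx (suc k)) (shift-suc j i) ⟩
  shiftIdx (suc k) (suc (shiftIdx j i))         ≡⟨ shift-suc k (shiftIdx j i) ⟩
  suc (shiftIdx k (shiftIdx j i))               ≡⟨ cong suc (shift-shift p i) ⟩
  suc (shiftIdx (suc j) (shiftIdx k i))         ≡⟨ sym (shift-suc (suc j) (shiftIdx k i)) ⟩
  shiftIdx (suc (suc j)) (suc (shiftIdx k i))   ≡⟨ cong (shiftIdx (suc (suc j))) (sym (shift-suc k i)) ⟩
  shiftIdx (suc (suc j)) (shiftIdx (suc k) (suc i)) ∎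
  where open ≡-Reasoning

shift-skips : ∀ k i → (shiftIdx k i ≡ᵇ k) ≡ false
shift-skips zero    i       = refl
shift-skips (suc k) zero    = refl
shift-skips (suc k) (suc i) = trans (cong (_≡ᵇ suc k) (shift-suc k i)) (shift-skips k i)

lower-shift : ∀ k i → lower k (shiftIdx k i) ≡ i
lower-shift zero    i       = refl
lower-shift (suc k) zero    = refl
lower-shift (suc k) (suc i) = begin
  lower (suc k) (shiftIdx (suc k) (suc i))  ≡⟨ cong (lower (suc k)) (shift-suc k i) ⟩
  lower (suc k) (suc (shiftIdx k i))        ≡⟨ lower-suc k (shiftIdx k i) (shift-skips k i) ⟩
  suc (lower k (shiftIdx k i))              ≡⟨ cong suc (lower-shift k i) ⟩
  suc i                                     ∎
  where open ≡-Reasoning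

shift-lower : ∀ k i → (i ≡ᵇ k) ≡ false → shiftIdx k (lower k i) ≡ i
shift-lower zero    zero    ()
shift-lower zero    (suc i) _ = refl
shift-lower (suc k) zero    _ = refl
shift-lower (suc k) (suc i) e = begin
  shiftIdx (suc k) (lower (suc k) (suc i))  ≡⟨ cong (shiftIdx (suc k)) (lower-suc k i e) ⟩
  shiftIdx (suc k) (suc (lower k i))        ≡⟨ shift-suc k (lower k i) ⟩
  suc (shiftIdx k (lower k i))              ≡⟨ cong suc (shift-lower k i e) ⟩
  suc i                                     ∎
  where open ≡-Reasoning

shift-self : ∀ k → shiftIdx k k ≡ suc k
shift-self zero    = refl
shift-self (suc k) = trans (shift-suc k k) (cong suc (shift-self k))

lower-suc-self : ∀ k → lower k (suc k) ≡ k
lower-suc-self k = trans (cong (lower k) (sym (shift-self k))) (lower-shift k k)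

shift-at : ∀ k → shiftIdx (suc k) k ≡ k
shift-at zero    = refl
shift-at (suc k) = trans (shift-suc (suc k) k) (cong suc (shift-at k))

shift-past : ∀ k i → (i ≡ᵇ k) ≡ false → shiftIdx (suc k) i ≡ shiftIdx k i
shift-past zero    zero    ()
shift-past zero    (suc i) _ = refl
shift-past (suc k) zero    _ = refl
shift-past (suc k) (suc i) e = begin
  shiftIdx (suc (suc k)) (suc i)  ≡⟨ shift-suc (suc k) i ⟩
  suc (shiftIdx (suc k) i)        ≡⟨ cong suc (shift-past k i e) ⟩
  suc (shiftIdx k i)              ≡⟨ sym (shift-suc k i) ⟩
  shiftIdx (suc k) (suc i)        ∎
  where open ≡-Reasoning

mutual
  tsh-tsh : ∀ {k j} → k ≤ j → ∀ t → LM.tsh k (LM.tsh j t) ≡ LM.tsh (suc j) (LM.tsh k t)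
  tsh-tsh p (LM.var i)   = cong LM.var (shift-shift p i)
  tsh-tsh p (LM.lam t)   = cong LM.lam (tsh-tsh (s≤s p) t)
  tsh-tsh p (LM.app t u) = cong₂ LM.app (tsh-tsh p t) (tsh-tsh p u)
  tsh-tsh p (LM.mu c)    = cong LM.mu (tsh-tshC p c)

  tsh-tshC : ∀ {k j} → k ≤ j → ∀ c → LM.tshC k (LM.tshC j c) ≡ LM.tshC (suc j) (LM.tshC k c)
  tsh-tshC p (LM.named a t) = cong (LM.named a) (tsh-tsh p t)

mutual
  nsh-nsh : ∀ {k j} → k ≤ j → ∀ t → LM.nsh k (LM.nsh j t) ≡ LM.nsh (suc j) (LM.nsh k t)
  nsh-nsh p (LM.var i)   = refl
  nsh-nsh p (LM.lam t)   = cong LM.lam (nsh-nsh p t)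
  nsh-nsh p (LM.app t u) = cong₂ LM.app (nsh-nsh p t) (nsh-nsh p u)
  nsh-nsh p (LM.mu c)    = cong LM.mu (nsh-nshC (s≤s p) c)

  nsh-nshC : ∀ {k j} → k ≤ j → ∀ c → LM.nshC k (LM.nshC j c) ≡ LM.nshC (suc j) (LM.nshC k c)
  nsh-nshC p (LM.named a t) = cong₂ LM.named (shift-shift p a) (nsh-nsh p t)

mutual
  nsh-tsh : ∀ k j t → LM.nsh k (LM.tsh j t) ≡ LM.tsh j (LM.nsh k t)
  nsh-tsh k j (LM.var i)   = refl
  nsh-tsh k j (LM.lam t)   = cong LM.lam (nsh-tsh k (suc j) t)
  nsh-tsh k j (LM.app t u) = cong₂ LM.app (nsh-tsh k j t) (nsh-tsh k j u)
  nsh-tsh k j (LM.mu c)    = cong LM.mu (nsh-tshC (suc k) j c)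

  nsh-tshC : ∀ k j c → LM.nshC k (LM.tshC j c) ≡ LM.tshC j (LM.nshC k c)
  nsh-tshC k j (LM.named a t) = cong (LM.named (shiftIdx k a)) (nsh-tsh k j t)

mutual
  ⌜tsh⌝ : ∀ k t → ⌜ LM.tsh k t ⌝ ≡ LMS.tsh k ⌜ t ⌝
  ⌜tsh⌝ k (LM.var i)   = refl
  ⌜tsh⌝ k (LM.lam t)   = cong LMS.lam (⌜tsh⌝ (suc k) t)
  ⌜tsh⌝ k (LM.app t u) = cong₂ LMS.app (⌜tsh⌝ k t) (⌜tsh⌝ k u)
  ⌜tsh⌝ k (LM.mu c)    = cong LMS.mu (⌜tshC⌝ k c)

  ⌜tshC⌝ : ∀ k c → ⌜ LM.tshC k c ⌝C ≡ LMS.tshC k ⌜ c ⌝C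
  ⌜tshC⌝ k (LM.named a t) = cong (LMS.named a) (⌜tsh⌝ k t)

mutual
  ⌜nsh⌝ : ∀ k t → ⌜ LM.nsh k t ⌝ ≡ LMS.nsh k ⌜ t ⌝
  ⌜nsh⌝ k (LM.var i)   = refl
  ⌜nsh⌝ k (LM.lam t)   = cong LMS.lam (⌜nsh⌝ k t)
  ⌜nsh⌝ k (LM.app t u) = cong₂ LMS.app (⌜nsh⌝ k t) (⌜nsh⌝ k u)
  ⌜nsh⌝ k (LM.mu c)    = cong LMS.mu (⌜nshC⌝ (suc k) c)

  ⌜nshC⌝ : ∀ k c → ⌜ LM.nshC k c ⌝C ≡ LMS.nshC k ⌜ c ⌝C
  ⌜nshC⌝ k (LM.named a t) = cong (LMS.named (shiftIdx k a)) (⌜nsh⌝ k t)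

eliminate : ∀ {X Y : Set} (_↝_ : Y → Y → Set) (count : X → ℕ) (start result : X → Y)
  → (∀ x → count x ≡ 0 → start x ↝ result x)
  → (∀ x → count x ≡ 1 → start x ↝ result x)
  → (∀ x n → count x ≡ suc (suc n)
       → Σ X λ x' → count x' ≡ suc n × start x ↝ start x' × result x' ≡ result x)
  → ∀ x → TransClosure _↝_ (start x) (result x)
eliminate {X} _↝_ count start result erase consume copy x = go (count x) x refl
  where
  go : ∀ n x → count x ≡ n → TransClosure _↝_ (start x) (result x)
  go zero          x e = [ erase x e ]
  go (suc zero)    x e = [ consume x e ]
  go (suc (suc n)) x e =
    let x' , e' , step , same = copy x n e
    in step ∷ subst (TransClosure _↝_ (start x')) same (go (suc n) x' e')

lift⁺ : ∀ {A B : Set} {R : A → A → Set} {S : B → B → Set} (f : A → B)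
      → (∀ {x y} → R x y → S (f x) (f y))
      → ∀ {x y} → TransClosure R x y → TransClosure S (f x) (f y)
lift⁺ f g [ r ]    = [ g r ]
lift⁺ f g (r ∷ rs) = g r ∷ lift⁺ f g rs

+-positive : ∀ m n → 0 < m + n → (0 < m) ⊎ (0 < n)
+-positive zero    n p = inj₂ p
+-positive (suc m) n p = inj₁ z<s

-- Term part: eliminating an explicit substitution t[x/u].

subst-var-other : ∀ k u j → (j ≡ᵇ k) ≡ false → LM.subst k u (LM.var j) ≡ LM.var (lower k j)
subst-var-other k u j e rewrite e with j <ᵇ k
... | true  = refl
... | false = refl

mutual
  subst-tsh : ∀ k u t → LM.subst k u (LM.tsh k t) ≡ t
  subst-tsh k u (LM.var j)   = trans (subst-var-other k u (shiftIdx k j) (shift-skips k j))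
                                     (cong LM.var (lower-shift k j))
  subst-tsh k u (LM.lam t)   = cong LM.lam (subst-tsh (suc k) (LM.tsh 0 u) t)
  subst-tsh k u (LM.app t s) = cong₂ LM.app (subst-tsh k u t) (subst-tsh k u s)
  subst-tsh k u (LM.mu c)    = cong LM.mu (subst-tshC k (LM.nsh 0 u) c)

  subst-tshC : ∀ k u c → LM.substC k u (LM.tshC k c) ≡ c
  subst-tshC k u (LM.named a t) = cong (LM.named a) (subst-tsh k u t)

mutual
  tsh-subst : ∀ i u t → LMS.cntT i ⌜ t ⌝ ≡ 0 → LM.tsh i (LM.subst i u t) ≡ t
  tsh-subst i u (LM.var j)   e = trans (cong (LM.tsh i) (subst-var-other i u j j≢i))
                                       (cong LM.var (shift-lower i j j≢i))
    where j≢i = ind-zero i j e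
  tsh-subst i u (LM.lam t)   e = cong LM.lam (tsh-subst (suc i) (LM.tsh 0 u) t e)
  tsh-subst i u (LM.app t s) e =
    cong₂ LM.app (tsh-subst i u t (m+n≡0⇒m≡0 _ e)) (tsh-subst i u s (m+n≡0⇒n≡0 _ e))
  tsh-subst i u (LM.mu c)    e = cong LM.mu (tsh-substC i (LM.nsh 0 u) c e)

  tsh-substC : ∀ i u c → LMS.cntTC i ⌜ c ⌝C ≡ 0 → LM.tshC i (LM.substC i u c) ≡ c
  tsh-substC i u (LM.named a t) e = cong (LM.named a) (tsh-subst i u t e)

mutual
  cntT-tsh : ∀ i t → LMS.cntT i ⌜ LM.tsh i t ⌝ ≡ 0
  cntT-tsh i (LM.var j)   rewrite ≡ᵇ-sym i (shiftIdx i j) | shift-skips i j = refl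
  cntT-tsh i (LM.lam t)   = cntT-tsh (suc i) t
  cntT-tsh i (LM.app t s) rewrite cntT-tsh i t | cntT-tsh i s = refl
  cntT-tsh i (LM.mu c)    = cntT-tshC i c

  cntT-tshC : ∀ i c → LMS.cntTC i ⌜ LM.tshC i c ⌝C ≡ 0
  cntT-tshC i (LM.named a t) = cntT-tsh i t

-- FillOne i u t t' : t' is t with one free occurrence of variable i replaced
-- by u (u lives outside the scope of i, hence is inserted as `tsh i u`).
mutual
  data FillOne : ℕ → LM.Tm → LM.Tm → LM.Tm → Set where
    here : ∀ {i u} → FillOne i u (LM.var i) (LM.tsh i u)
    lamᶜ : ∀ {i u t t'} → FillOne (suc i) (LM.tsh 0 u) t t' → FillOne i u (LM.lam t) (LM.lam t')
    appˡ : ∀ {i u t t' s} → FillOne i u t t' → FillOne i u (LM.app t s) (LM.app t' s)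
    appʳ : ∀ {i u t s s'} → FillOne i u s s' → FillOne i u (LM.app t s) (LM.app t s')
    muᶜ  : ∀ {i u c c'} → FillOneC i (LM.nsh 0 u) c c' → FillOne i u (LM.mu c) (LM.mu c')

  data FillOneC : ℕ → LM.Tm → LM.Cmd → LM.Cmd → Set where
    namedᶜ : ∀ {i u a t t'} → FillOne i u t t' → FillOneC i u (LM.named a t) (LM.named a t')

mutual
  fill-count : ∀ {i u t t'} → FillOne i u t t' → LMS.cntT i ⌜ t ⌝ ≡ suc (LMS.cntT i ⌜ t' ⌝)
  fill-count {i} {u} here rewrite ≡ᵇ-refl i | cntT-tsh i u = refl
  fill-count (lamᶜ r) = fill-count r
  fill-count {i} {t = LM.app t s} (appˡ r) = cong (_+ LMS.cntT i ⌜ s ⌝) (fill-count r)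
  fill-count {i} {t = LM.app t s} (appʳ r) =
    trans (cong (LMS.cntT i ⌜ t ⌝ +_) (fill-count r)) (+-suc (LMS.cntT i ⌜ t ⌝) _)
  fill-count (muᶜ r) = fill-countC r

  fill-countC : ∀ {i u c c'} → FillOneC i u c c' → LMS.cntTC i ⌜ c ⌝C ≡ suc (LMS.cntTC i ⌜ c' ⌝C)
  fill-countC (namedᶜ r) = fill-count r

mutual
  fill-subst : ∀ {i u t t'} → FillOne i u t t' → LM.subst i u t' ≡ LM.subst i u t
  fill-subst {i} {u} here rewrite ≡ᵇ-refl i = subst-tsh i u u
  fill-subst (lamᶜ r) = cong LM.lam (fill-subst r)
  fill-subst (appˡ r) = cong (λ z → LM.app z _) (fill-subst r)
  fill-subst (appʳ r) = cong (LM.app _) (fill-subst r)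
  fill-subst (muᶜ r)  = cong LM.mu (fill-substC r)

  fill-substC : ∀ {i u c c'} → FillOneC i u c c' → LM.substC i u c' ≡ LM.substC i u c
  fill-substC (namedᶜ r) = cong (LM.named _) (fill-subst r)

mutual
  fill-exists : ∀ i u t → 0 < LMS.cntT i ⌜ t ⌝ → Σ LM.Tm (FillOne i u t)
  fill-exists i u (LM.var j) p with i ≡ᵇ j in e
  ... | true rewrite ≡ᵇ-sound i j e = _ , here
  fill-exists i u (LM.var j) () | false
  fill-exists i u (LM.lam t) p with fill-exists (suc i) (LM.tsh 0 u) t p
  ... | t' , r = _ , lamᶜ r
  fill-exists i u (LM.app t s) p with +-positive (LMS.cntT i ⌜ t ⌝) _ p
  ... | inj₁ q with fill-exists i u t q
  ...   | t' , r = _ , appˡ r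
  fill-exists i u (LM.app t s) p | inj₂ q with fill-exists i u s q
  ...   | s' , r = _ , appʳ r
  fill-exists i u (LM.mu c) p with fill-existsC i (LM.nsh 0 u) c p
  ... | c' , r = _ , muᶜ r

  fill-existsC : ∀ i u c → 0 < LMS.cntTC i ⌜ c ⌝C → Σ LM.Cmd (FillOneC i u c)
  fill-existsC i u (LM.named a t) p with fill-exists i u t p
  ... | t' , r = _ , namedᶜ r

mutual
  fill-translate : ∀ {i u t t'} → FillOne i u t t' → LMS.RepT i ⌜ LM.tsh i u ⌝ ⌜ t ⌝ ⌜ t' ⌝
  fill-translate here = LMS.here
  fill-translate {i} {u} (lamᶜ r) =
    LMS.lamᶜ (subst (λ v → LMS.RepT (suc i) v _ _)
      (trans (cong ⌜_⌝ (sym (tsh-tsh z≤n u))) (⌜tsh⌝ 0 (LM.tsh i u))) (fill-translate r))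
  fill-translate (appˡ r) = LMS.appˡ (fill-translate r)
  fill-translate (appʳ r) = LMS.appʳ (fill-translate r)
  fill-translate {i} {u} (muᶜ r) =
    LMS.muᶜ (subst (λ v → LMS.RepTC i v _ _)
      (trans (cong ⌜_⌝ (sym (nsh-tsh 0 i u))) (⌜nsh⌝ 0 (LM.tsh i u))) (fill-translateC r))

  fill-translateC : ∀ {i u c c'} → FillOneC i u c c' → LMS.RepTC i ⌜ LM.tsh i u ⌝ ⌜ c ⌝C ⌜ c' ⌝C
  fill-translateC (namedᶜ r) = LMS.namedᶜ (fill-translate r)

esub-elimination : ∀ u t → LMS.esub ⌜ t ⌝ ⌜ u ⌝ LMS.⟶⁺ ⌜ LM.subst 0 u t ⌝
esub-elimination u = eliminate LMS._⟶_ count start result erase consume copy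
  where
  count : LM.Tm → ℕ
  count t = LMS.cntT 0 ⌜ t ⌝

  start result : LM.Tm → LMS.Tm
  start  t = LMS.esub ⌜ t ⌝ ⌜ u ⌝
  result t = ⌜ LM.subst 0 u t ⌝

  unshifted : ∀ t → count t ≡ 0 → LMS.tsh 0 (result t) ≡ ⌜ t ⌝
  unshifted t e = trans (sym (⌜tsh⌝ 0 (LM.subst 0 u t))) (cong ⌜_⌝ (tsh-subst 0 u t e))

  fill-top : ∀ {t t'} → FillOne 0 u t t' → LMS.RepT 0 (LMS.tsh 0 ⌜ u ⌝) ⌜ t ⌝ ⌜ t' ⌝
  fill-top r = subst (λ v → LMS.RepT 0 v _ _) (⌜tsh⌝ 0 u) (fill-translate r)

  pick : ∀ t n → count t ≡ suc n → Σ LM.Tm λ t' → FillOne 0 u t t' × count t' ≡ n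
  pick t n e with fill-exists 0 u t (subst (0 <_) (sym e) z<s)
  ... | t' , r = t' , r , suc-injective (trans (sym (fill-count r)) e)

  erase : ∀ t → count t ≡ 0 → start t LMS.⟶ result t
  erase t e = subst (λ z → LMS.esub z ⌜ u ⌝ LMS.⟶ result t) (unshifted t e) LMS.wᵗ

  consume : ∀ t → count t ≡ 1 → start t LMS.⟶ result t
  consume t e with pick t 0 e
  ... | t' , r , e' = subst (start t LMS.⟶_) (cong ⌜_⌝ (fill-subst r))
                        (LMS.dᵗ (fill-top r) e (unshifted t' e'))

  copy : ∀ t n → count t ≡ suc (suc n)
       → Σ LM.Tm λ t' → count t' ≡ suc n × start t LMS.⟶ start t' × result t' ≡ result t
  copy t n e with pick t (suc n) e
  ... | t' , r , e' = t' , e' , LMS.cᵗ (fill-top r) (subst (1 <_) (sym e) (s<s z<s))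
                    , cong ⌜_⌝ (fill-subst r)

-- Name part: eliminating an explicit replacement c⟨α//γ.u⟩.

-- redirect a w c: with α = a and γ = a+1, turn every [α]t into [γ](t w) and
-- remove the then unused name α.  This is the result of eliminating
-- c⟨α//γ.w⟩, and equals c{α//w} (α renamed γ) when γ does not occur in c.
redirectNamed : ℕ → LM.Tm → ℕ → LM.Tm → LM.Cmd
redirectNamed a w b t = if b ≡ᵇ a then LM.named a (LM.app t w) else LM.named (lower a b) t

mutual
  redirect : ℕ → LM.Tm → LM.Tm → LM.Tm
  redirect a w (LM.var x)   = LM.var x
  redirect a w (LM.lam t)   = LM.lam (redirect a (LM.tsh 0 w) t)
  redirect a w (LM.app t s) = LM.app (redirect a w t) (redirect a w s)
  redirect a w (LM.mu c)    = LM.mu (redirectC (suc a) (LM.nsh 0 w) c)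

  redirectC : ℕ → LM.Tm → LM.Cmd → LM.Cmd
  redirectC a w (LM.named b t) = redirectNamed a w b (redirect a w t)

mutual
  redirect-replaces : ∀ a w t → redirect a w (LM.nsh (suc a) t) ≡ LM.repl a w t
  redirect-replaces a w (LM.var x)   = refl
  redirect-replaces a w (LM.lam t)   = cong LM.lam (redirect-replaces a (LM.tsh 0 w) t)
  redirect-replaces a w (LM.app t s) = cong₂ LM.app (redirect-replaces a w t) (redirect-replaces a w s)
  redirect-replaces a w (LM.mu c)    = cong LM.mu (redirect-replacesC (suc a) (LM.nsh 0 w) c)

  redirect-replacesC : ∀ a w c → redirectC a w (LM.nshC (suc a) c) ≡ LM.replC a w c
  redirect-replacesC a w (LM.named b t) rewrite redirect-replaces a w t with b ≡ᵇ a in e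
  ... | true  rewrite ≡ᵇ-sound b a e | shift-at a | ≡ᵇ-refl a = refl
  ... | false rewrite shift-past a b e | shift-skips a b = cong (λ z → LM.named z _) (lower-shift a b)

mutual
  redirect-nsh : ∀ a w t → redirect a w (LM.nsh a t) ≡ t
  redirect-nsh a w (LM.var x)   = refl
  redirect-nsh a w (LM.lam t)   = cong LM.lam (redirect-nsh a (LM.tsh 0 w) t)
  redirect-nsh a w (LM.app t s) = cong₂ LM.app (redirect-nsh a w t) (redirect-nsh a w s)
  redirect-nsh a w (LM.mu c)    = cong LM.mu (redirect-nshC (suc a) (LM.nsh 0 w) c)

  redirect-nshC : ∀ a w c → redirectC a w (LM.nshC a c) ≡ c
  redirect-nshC a w (LM.named b t) rewrite redirect-nsh a w t | shift-skips a b =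
    cong (λ z → LM.named z t) (lower-shift a b)

mutual
  nsh-redirect : ∀ a w t → LMS.cntN a ⌜ t ⌝ ≡ 0 → LM.nsh a (redirect a w t) ≡ t
  nsh-redirect a w (LM.var x)   e = refl
  nsh-redirect a w (LM.lam t)   e = cong LM.lam (nsh-redirect a (LM.tsh 0 w) t e)
  nsh-redirect a w (LM.app t s) e =
    cong₂ LM.app (nsh-redirect a w t (m+n≡0⇒m≡0 _ e)) (nsh-redirect a w s (m+n≡0⇒n≡0 _ e))
  nsh-redirect a w (LM.mu c)    e = cong LM.mu (nsh-redirectC (suc a) (LM.nsh 0 w) c e)

  nsh-redirectC : ∀ a w c → LMS.cntNC a ⌜ c ⌝C ≡ 0 → LM.nshC a (redirectC a w c) ≡ c
  nsh-redirectC a w (LM.named b t) e rewrite ind-zero a b (m+n≡0⇒m≡0 _ e) =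
    cong₂ LM.named (shift-lower a b (ind-zero a b (m+n≡0⇒m≡0 _ e))) (nsh-redirect a w t (m+n≡0⇒n≡0 _ e))

mutual
  cntN-nsh : ∀ a t → LMS.cntN a ⌜ LM.nsh a t ⌝ ≡ 0
  cntN-nsh a (LM.var x)   = refl
  cntN-nsh a (LM.lam t)   = cntN-nsh a t
  cntN-nsh a (LM.app t s) rewrite cntN-nsh a t | cntN-nsh a s = refl
  cntN-nsh a (LM.mu c)    = cntN-nshC (suc a) c

  cntN-nshC : ∀ a c → LMS.cntNC a ⌜ LM.nshC a c ⌝C ≡ 0
  cntN-nshC a (LM.named b t) rewrite ≡ᵇ-sym a (shiftIdx a b) | shift-skips a b | cntN-nsh a t = refl

-- RedirectOne a w c c' : c' is c with one command [α]t replaced by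
-- [γ](t w), where α = a, γ = a+1 (w lives outside the scope of α).
mutual
  data RedirectOne : ℕ → LM.Tm → LM.Cmd → LM.Cmd → Set where
    here   : ∀ {a w t} → RedirectOne a w (LM.named a t) (LM.named (suc a) (LM.app t (LM.nsh a w)))
    namedᶜ : ∀ {a w b t t'} → RedirectOneT a w t t' → RedirectOne a w (LM.named b t) (LM.named b t')

  data RedirectOneT : ℕ → LM.Tm → LM.Tm → LM.Tm → Set where
    lamᶜ : ∀ {a w t t'} → RedirectOneT a (LM.tsh 0 w) t t' → RedirectOneT a w (LM.lam t) (LM.lam t')
    appˡ : ∀ {a w t t' s} → RedirectOneT a w t t' → RedirectOneT a w (LM.app t s) (LM.app t' s)
    appʳ : ∀ {a w t s s'} → RedirectOneT a w s s' → RedirectOneT a w (LM.app t s) (LM.app t s')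
    muᶜ  : ∀ {a w c c'} → RedirectOne (suc a) (LM.nsh 0 w) c c' → RedirectOneT a w (LM.mu c) (LM.mu c')

mutual
  redirect-count : ∀ {a w c c'} → RedirectOne a w c c' → LMS.cntNC a ⌜ c ⌝C ≡ suc (LMS.cntNC a ⌜ c' ⌝C)
  redirect-count {a} {w} {LM.named .a t} here
    rewrite ≡ᵇ-refl a | ≡ᵇ-sym a (suc a) | suc-≢ᵇ a | cntN-nsh a w | +-identityʳ (LMS.cntN a ⌜ t ⌝) = refl
  redirect-count {a} (namedᶜ {b = b} r) rewrite redirect-countT r = +-suc (LMS.ind (a ≡ᵇ b)) _

  redirect-countT : ∀ {a w t t'} → RedirectOneT a w t t' → LMS.cntN a ⌜ t ⌝ ≡ suc (LMS.cntN a ⌜ t' ⌝)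
  redirect-countT (lamᶜ r) = redirect-countT r
  redirect-countT {a} {t = LM.app t s} (appˡ r) = cong (_+ LMS.cntN a ⌜ s ⌝) (redirect-countT r)
  redirect-countT {a} {t = LM.app t s} (appʳ r) =
    trans (cong (LMS.cntN a ⌜ t ⌝ +_) (redirect-countT r)) (+-suc (LMS.cntN a ⌜ t ⌝) _)
  redirect-countT (muᶜ r) = redirect-count r

mutual
  redirect-stable : ∀ {a w c c'} → RedirectOne a w c c' → redirectC a w c' ≡ redirectC a w c
  redirect-stable {a} {w} here
    rewrite ≡ᵇ-refl a | suc-≢ᵇ a | lower-suc-self a | redirect-nsh a w w = refl
  redirect-stable (namedᶜ r) rewrite redirect-stableT r = refl

  redirect-stableT : ∀ {a w t t'} → RedirectOneT a w t t' → redirect a w t' ≡ redirect a w t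
  redirect-stableT (lamᶜ r) = cong LM.lam (redirect-stableT r)
  redirect-stableT (appˡ r) = cong (λ z → LM.app z _) (redirect-stableT r)
  redirect-stableT (appʳ r) = cong (LM.app _) (redirect-stableT r)
  redirect-stableT (muᶜ r)  = cong LM.mu (redirect-stable r)

mutual
  redirect-exists : ∀ a w c → 0 < LMS.cntNC a ⌜ c ⌝C → Σ LM.Cmd (RedirectOne a w c)
  redirect-exists a w (LM.named b t) p with a ≡ᵇ b in e
  ... | true rewrite ≡ᵇ-sound a b e = _ , here
  ... | false with redirect-existsT a w t p
  ...   | t' , r = _ , namedᶜ r

  redirect-existsT : ∀ a w t → 0 < LMS.cntN a ⌜ t ⌝ → Σ LM.Tm (RedirectOneT a w t)
  redirect-existsT a w (LM.var x) ()
  redirect-existsT a w (LM.lam t) p with redirect-existsT a (LM.tsh 0 w) t p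
  ... | t' , r = _ , lamᶜ r
  redirect-existsT a w (LM.app t s) p with +-positive (LMS.cntN a ⌜ t ⌝) _ p
  ... | inj₁ q with redirect-existsT a w t q
  ...   | t' , r = _ , appˡ r
  redirect-existsT a w (LM.app t s) p | inj₂ q with redirect-existsT a w s q
  ...   | s' , r = _ , appʳ r
  redirect-existsT a w (LM.mu c) p with redirect-exists (suc a) (LM.nsh 0 w) c p
  ... | c' , r = _ , muᶜ r

mutual
  redirect-translate : ∀ {a w c c'} → RedirectOne a w c c'
                     → LMS.RepN a (suc a) ⌜ LM.nsh a w ⌝ ⌜ c ⌝C ⌜ c' ⌝C
  redirect-translate here       = LMS.here
  redirect-translate (namedᶜ r) = LMS.namedᶜ (redirect-translateT r)

  redirect-translateT : ∀ {a w t t'} → RedirectOneT a w t t'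
                      → LMS.RepNT a (suc a) ⌜ LM.nsh a w ⌝ ⌜ t ⌝ ⌜ t' ⌝
  redirect-translateT {a} {w} (lamᶜ r) =
    LMS.lamᶜ (subst (λ v → LMS.RepNT a (suc a) v _ _)
      (trans (cong ⌜_⌝ (nsh-tsh a 0 w)) (⌜tsh⌝ 0 (LM.nsh a w))) (redirect-translateT r))
  redirect-translateT (appˡ r) = LMS.appˡ (redirect-translateT r)
  redirect-translateT (appʳ r) = LMS.appʳ (redirect-translateT r)
  redirect-translateT {a} {w} (muᶜ r) =
    LMS.muᶜ (subst (λ v → LMS.RepN (suc a) (suc (suc a)) v _ _)
      (trans (cong ⌜_⌝ (sym (nsh-nsh z≤n w))) (⌜nsh⌝ 0 (LM.nsh a w))) (redirect-translate r))

rsub-elimination : ∀ w c → LMS.rsub ⌜ c ⌝C 0 ⌜ w ⌝ LMS.⟶C⁺ ⌜ redirectC 0 w c ⌝C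
rsub-elimination w = eliminate LMS._⟶C_ count start result erase consume copy
  where
  count : LM.Cmd → ℕ
  count c = LMS.cntNC 0 ⌜ c ⌝C

  start result : LM.Cmd → LMS.Cmd
  start  c = LMS.rsub ⌜ c ⌝C 0 ⌜ w ⌝
  result c = ⌜ redirectC 0 w c ⌝C

  unshifted : ∀ c → count c ≡ 0 → LMS.nshC 0 (result c) ≡ ⌜ c ⌝C
  unshifted c e = trans (sym (⌜nshC⌝ 0 (redirectC 0 w c))) (cong ⌜_⌝C (nsh-redirectC 0 w c e))

  redirect-top : ∀ {c c'} → RedirectOne 0 w c c' → LMS.RepN 0 1 (LMS.nsh 0 ⌜ w ⌝) ⌜ c ⌝C ⌜ c' ⌝C
  redirect-top r = subst (λ v → LMS.RepN 0 1 v _ _) (⌜nsh⌝ 0 w) (redirect-translate r)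

  pick : ∀ c n → count c ≡ suc n → Σ LM.Cmd λ c' → RedirectOne 0 w c c' × count c' ≡ n
  pick c n e with redirect-exists 0 w c (subst (0 <_) (sym e) z<s)
  ... | c' , r = c' , r , suc-injective (trans (sym (redirect-count r)) e)

  erase : ∀ c → count c ≡ 0 → start c LMS.⟶C result c
  erase c e = subst (λ z → LMS.rsub z 0 ⌜ w ⌝ LMS.⟶C result c) (unshifted c e) LMS.wⁿ

  consume : ∀ c → count c ≡ 1 → start c LMS.⟶C result c
  consume c e with pick c 0 e
  ... | c' , r , e' = subst (start c LMS.⟶C_) (cong ⌜_⌝C (redirect-stable r))
                        (LMS.dⁿ (redirect-top r) e (unshifted c' e'))

  copy : ∀ c n → count c ≡ suc (suc n)
       → Σ LM.Cmd λ c' → count c' ≡ suc n × start c LMS.⟶C start c' × result c' ≡ result c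
  copy c n e with pick c (suc n) e
  ... | c' , r , e' = c' , e' , LMS.cⁿ (redirect-top r) (subst (1 <_) (sym e) (s<s z<s))
                    , cong ⌜_⌝C (redirect-stable r)

μ-body-elimination : ∀ c u → LMS.rsub (LMS.nshC 1 ⌜ c ⌝C) 0 (LMS.nsh 0 ⌜ u ⌝)
                             LMS.⟶C⁺ ⌜ LM.replC 0 (LM.nsh 0 u) c ⌝C
μ-body-elimination c u =
  subst₂ (λ d r → LMS.rsub d 0 r LMS.⟶C⁺ ⌜ LM.replC 0 (LM.nsh 0 u) c ⌝C) (⌜nshC⌝ 1 c) (⌜nsh⌝ 0 u)
    (subst (λ d → LMS.rsub ⌜ LM.nshC 1 c ⌝C 0 ⌜ LM.nsh 0 u ⌝ LMS.⟶C⁺ ⌜ d ⌝C)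
      (redirect-replacesC 0 (LM.nsh 0 u) c)
      (rsub-elimination (LM.nsh 0 u) (LM.nshC 1 c)))

mutual
  simulate : ∀ {t t'} → t LM.⟶ t' → ⌜ t ⌝ LMS.⟶⁺ ⌜ t' ⌝
  simulate (LM.β {t} {u})      = LMS.dB {L = LMS.□} ∷ esub-elimination u t
  simulate (LM.μ {c} {u})      = LMS.dM {L = LMS.□} ∷ lift⁺ LMS.mu LMS.muᶜ (μ-body-elimination c u)
  simulate (LM.lamᶜ r)         = lift⁺ LMS.lam LMS.lamᶜ (simulate r)
  simulate (LM.appˡ {u = u} r) = lift⁺ (λ z → LMS.app z ⌜ u ⌝) LMS.appˡ (simulate r)
  simulate (LM.appʳ {t = t} r) = lift⁺ (LMS.app ⌜ t ⌝) LMS.appʳ (simulate r)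
  simulate (LM.muᶜ r)          = lift⁺ LMS.mu LMS.muᶜ (simulateC r)

  simulateC : ∀ {c c'} → c LM.⟶C c' → ⌜ c ⌝C LMS.⟶C⁺ ⌜ c' ⌝C
  simulateC (LM.namedᶜ {a = a} r) = lift⁺ (LMS.named a) LMS.namedᶜ (simulate r)

lemma7p1 : ((t t' : LM.Tm) → t LM.⟶ t' → ⌜ t ⌝ LMS.⟶⁺ ⌜ t' ⌝)
         × ((c c' : LM.Cmd) → c LM.⟶C c' → ⌜ c ⌝C LMS.⟶C⁺ ⌜ c' ⌝C)
lemma7p1 = (λ t t' → simulate) , (λ c c' → simulateC)
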